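{- Let $\mathcal{G}=(H,\sigma,\alpha,h_0)$ be a rooted combinatorial map with underlying graph $G=(V,E)$, let $T$ be a spanning tree and let $S$ be a subgraph in the tree-interval $[T^-,T^+]$. Let $c(S)$ be the number of connected components of the spanning subgraph $(V,S)$. Then $c(S)-1=|T\setminus S|$ and $|S|+c(S)-|V|=|S\setminus T|$.
   Context: A rooted combinatorial map is $\mathcal{G}=(H,\sigma,\alpha,h_0)$ where $H$ is a finite set of half-edges, $\sigma$ is a permutation of $H$, $\alpha$ a fixed-point-free involution of $H$, the group generated by $\sigma,\alpha$ acts transitively on $H$, and $h_0\in H$ is the root. Its underlying graph $G=(V,E)$ has the cycles of $\sigma$ as vertices and the pairs $\{h,\alpha(h)\}$ as edges, the endpoints of an edge being the vertices containing its two half-edges (loops and multiple edges allowed). Subgraphs are spanning and identified with edge sets. For a spanning tree $T$, edges in $T$ are internal, others external. The motion function is $t(h)=\sigma\alpha(h)$ if the edge of $h$ is internal, $t(h)=\sigma(h)$ otherwise (a cyclic permutation of $H$). The $(\mathcal{G},T)$-order on $H$ is $h_0<t(h_0)<\dots<t^{|H|-1}(h_0)$; edges are compared via their smaller half-edge. The fundamental cycle of an external edge $e$ is the set of $e'$ with $T-e'+e$ a spanning tree; the fundamental cocycle of an internal edge $e$ is the set of $e'$ with $T-e+e'$ a spanning tree. An edge is $(\mathcal{G},T)$-active if it is minimal for the $(\mathcal{G},T)$-order in its fundamental cycle (external case) or fundamental cocycle (internal case). The tree-interval $[T^-,T^+]$ is the set of subgraphs obtained from $T$ by removing some internal $(\mathcal{G},T)$-active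 edges and adding some external $(\mathcal{G},T)$-active edges. -}

module Defs where

open import Data.Nat using (ℕ; zero; suc; _≤_; _<_; _+_; _%_; _<?_)
open import Data.Nat.DivMod using (m%n<n)
open import Data.Integer using (ℤ; +_; _-_)
open import Data.Fin using (Fin; toℕ; fromℕ<)
open import Data.Fin.Subset using (Subset; _∈_; _∉_; _∩_; _∪_; _─_; ⁅_⁆; ∣_∣)
open import Data.Fin.Permutation using (Permutation′; _⟨$⟩ʳ_; _⟨$⟩ˡ_)
open import Data.Vec using (tabulate)
open import Data.Bool using (Bool)
import Data.Fin.Subset.Properties
open import Data.Product using (Σ; ∃; ∃-syntax; _×_; _,_)
open import Data.Sum using (_⊎_)
open import Function using (_⇔_)
open import Relation.Nullary using (¬_; does)
open import Relation.Binary.PropositionalEquality using (_≡_; _≢_)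
open import Relation.Binary.Construct.Closure.ReflexiveTransitive using (Star)

cnext : ∀ {k} → Fin (suc k) → Fin (suc k)
cnext {k} i = fromℕ< (m%n<n (toℕ i + 1) (suc k))

iter : ∀ {A : Set} → (A → A) → ℕ → A → A
iter f zero x = x
iter f (suc k) x = f (iter f k x)

data GenStep {n : ℕ} (σ α : Permutation′ n) : Fin n → Fin n → Set where
  σ-step  : ∀ h → GenStep σ α h (σ ⟨$⟩ʳ h)
  σ⁻-step : ∀ h → GenStep σ α h (σ ⟨$⟩ˡ h)
  α-step  : ∀ h → GenStep σ α h (α ⟨$⟩ʳ h)

record RootedMap (n : ℕ) : Set where
  field
    σ : Permutation′ n
    α : Permutation′ n
    α-invol : ∀ h → α ⟨$⟩ʳ (α ⟨$⟩ʳ h) ≡ h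
    α-fpf : ∀ h → α ⟨$⟩ʳ h ≢ h
    transitive : ∀ h h′ → Star (GenStep σ α) h h′
    root : Fin n

-- "the equivalence relation R on Fin n has exactly k classes":
-- a surjection onto Fin k whose fibres are exactly the R-classes
HasClasses : ∀ {n} → (Fin n → Fin n → Set) → ℕ → Set
HasClasses {n} R k =
  Σ (Fin n → Fin k) λ f →
    (∀ (i : Fin k) → ∃[ h ] f h ≡ i) ×
    (∀ h h′ → (f h ≡ f h′) ⇔ R h h′)

module _ {n : ℕ} (M : RootedMap n) where
  open RootedMap M

  σf αf : Fin n → Fin n
  σf h = σ ⟨$⟩ʳ h
  αf h = α ⟨$⟩ʳ h

  SameVertex : Fin n → Fin n → Set
  SameVertex h h′ = ∃[ k ] iter σf k h ≡ h′

  NumVertices : ℕ → Set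
  NumVertices v = HasClasses SameVertex v

  -- subgraphs (edge sets) are represented by α-closed sets of half-edges
  EdgeSet : Subset n → Set
  EdgeSet S = ∀ h → h ∈ S → αf h ∈ S

  edge : Fin n → Subset n
  edge h = ⁅ h ⁆ ∪ ⁅ αf h ⁆

  -- canonical half-edge of each edge: h with h < α h
  canon : Subset n
  canon = tabulate (λ h → does (toℕ h <? toℕ (αf h)))

  #E : Subset n → ℕ
  #E S = ∣ S ∩ canon ∣

  data CompStep (S : Subset n) : Fin n → Fin n → Set where
    around  : ∀ h → CompStep S h (σf h)
    around⁻ : ∀ h → CompStep S h (σ ⟨$⟩ˡ h)
    cross   : ∀ h → h ∈ S → CompStep S h (αf h)

  Connected : Subset n → Fin n → Fin n → Set
  Connected S = Star (CompStep S)

  -- c(S) = c : number of connected components of (V,S)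
  -- (every vertex carries at least one half-edge, so classes of half-edges
  --  correspond to components)
  NumComponents : Subset n → ℕ → Set
  NumComponents S c = HasClasses (Connected S) c

  record Cycle (S : Subset n) : Set where
    field
      len : ℕ
      hs : Fin (suc len) → Fin n
      inS : ∀ i → hs i ∈ S
      distinctEdges : ∀ i j → i ≢ j → (hs i ≢ hs j) × (hs i ≢ αf (hs j))
      distinctVertices : ∀ i j → i ≢ j → ¬ SameVertex (hs i) (hs j)
      chained : ∀ i → SameVertex (αf (hs i)) (hs (cnext i))

  IsSpanningTree : Subset n → Set
  IsSpanningTree T = EdgeSet T × (∀ h h′ → Connected T h h′) × ¬ Cycle T

  module Tree (T : Subset n) where
    t : Fin n → Fin n
    t h with does (Data.Fin.Subset.Properties._∈?_ h T)
    ... | Bool.true = σf (αf h)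
    ... | Bool.false = σf h

    Pos : Fin n → ℕ → Set
    Pos h i = (i < n) × (iter t i root ≡ h)

    _≤H_ : Fin n → Fin n → Set
    h ≤H h′ = ∃[ i ] ∃[ j ] Pos h i × Pos h′ j × (i ≤ j)

    -- edges compared via their smaller half-edge:
    -- min(e) ≤ min(e′) iff some half-edge of e is ≤ every half-edge of e′
    _≤E_ : Fin n → Fin n → Set
    e ≤E e′ = ∃[ a ] (a ∈ edge e) × (∀ b → b ∈ edge e′ → a ≤H b)

    InFundCycle : Fin n → Fin n → Set
    InFundCycle e e′ = IsSpanningTree ((T ─ edge e′) ∪ edge e)

    InFundCocycle : Fin n → Fin n → Set
    InFundCocycle e e′ = IsSpanningTree ((T ─ edge e) ∪ edge e′)

    ExternallyActive : Fin n → Set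
    ExternallyActive e = e ∉ T × (∀ e′ → InFundCycle e e′ → e ≤E e′)

    InternallyActive : Fin n → Set
    InternallyActive e = e ∈ T × (∀ e′ → InFundCocycle e e′ → e ≤E e′)

    InTreeInterval : Subset n → Set
    InTreeInterval S =
      EdgeSet S ×
      (∀ h → h ∈ T → h ∉ S → InternallyActive h) ×
      (∀ h → h ∉ T → h ∈ S → ExternallyActive h)

{-# OPTIONS --safe #-}
-- Write K = T ∩ S. Every edge of a forest is a bridge, so adding the edges of K one at a time to the
-- edgeless graph merges two components each time: c(K) + |K| = |V|, and likewise 1 + |T| = |V|,
-- whence c(K) = 1 + |T ∖ S|. The edges a ∈ S ∖ T do not change the components of K: if the endpoints
-- of a were separated in K, the path of T joining them would cross some d ∈ T ∖ S, and T − d + a would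
-- be a spanning tree. Then d lies in the fundamental cycle of a and a in the fundamental cocycle of d,
-- so activity makes each of a, d smaller than the other in the (G,T)-order. That order is linear,
-- because the motion function of a spanning tree is a single cycle; hence a and d would be the same
-- edge, although only d is in T. So c(S) = c(K), and both identities follow from
-- |T| = |K| + |T ∖ S| and |S| = |K| + |S ∖ T|.
module Submission where

module TreeInterval where

  open import Defs
  open import Data.Nat using (ℕ; zero; suc; _+_; _*_; _%_; _/_; _≤_; _<_; z≤n; s≤s; s≤s⁻¹)
  import Data.Nat.Properties as ℕP
  open import Data.Nat.Tactic.RingSolver using (solve-∀)
  open import Data.Nat.DivMod using (m<n⇒m%n≡m; n%n≡0; m%n<n; m≡m%n+[m/n]*n)
  open import Data.Fin using (Fin; zero; suc; toℕ; fromℕ; fromℕ<; punchIn; punchOut; _≟_)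
  import Data.Fin.Properties as FP
  open import Data.Fin.Subset using (Subset; _∈_; _∉_; _∩_; _∪_; _─_; _⊆_; ⁅_⁆; ⊥; ∣_∣; inside; outside)
  import Data.Fin.Subset.Properties as SP
  open import Data.Fin.Permutation using (_⟨$⟩ˡ_; inverseˡ; inverseʳ)
  open import Data.Vec using ([]; _∷_; here; there)
  import Data.Vec.Properties as VP
  open import Data.List using (List; []; _∷_; length; lookup)
  import Data.List.Relation.Unary.All as All
  open All using (All; []; _∷_)
  open import Data.List.Relation.Unary.AllPairs using (AllPairs; []; _∷_)
  open import Data.List.Membership.Propositional.Properties using (∈-lookup)
  open import Data.Product using (∃-syntax; _×_; _,_; proj₁; proj₂)
  open import Data.Sum using (_⊎_; inj₁; inj₂; [_,_]′)
  import Data.Sum as Sum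
  import Data.Product as Product
  open import Data.Empty using (⊥-elim)
  open import Function using (_⇔_; _∘_; id; case_of_; mk⇔; Equivalence)
  open import Function.Definitions using (Injective)
  open import Relation.Nullary using (¬_; yes; no)
  open import Relation.Nullary.Decidable using (dec-true; dec-false; decidable-stable)
  open import Relation.Binary.PropositionalEquality
  open import Relation.Binary.Construct.Closure.ReflexiveTransitive using (Star; ε; _◅_; _◅◅_; _⋆)
  import Relation.Binary.Construct.Closure.ReflexiveTransitive as Star
  open import Relation.Binary.Definitions using (tri<; tri≈; tri>)

  -- Finite sets and counting

  x∈p─q⇒x∉q : ∀ {m} {x : Fin m} (p q : Subset m) → x ∈ p ─ q → x ∉ q
  x∈p─q⇒x∉q (_ ∷ p) (outside ∷ q) here ()
  x∈p─q⇒x∉q (_ ∷ p) (_ ∷ q) (there x∈p─q) (there x∈q) = x∈p─q⇒x∉q p q x∈p─q x∈q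

  p─[q─r]⊆[p─q]∪r : ∀ {m} (p q r : Subset m) → p ─ (q ─ r) ⊆ (p ─ q) ∪ r
  p─[q─r]⊆[p─q]∪r p q r {x} x∈ with x SP.∈? r
  ... | yes x∈r = SP.x∈p∪q⁺ (inj₂ x∈r)
  ... | no x∉r  = SP.x∈p∪q⁺ (inj₁ (SP.x∈p∧x∉q⇒x∈p─q (SP.p─q⊆p p _ x∈)
                    (λ x∈q → x∈p─q⇒x∉q p (q ─ r) x∈ (SP.x∈p∧x∉q⇒x∈p─q x∈q x∉r))))

  p─-antitone : ∀ {m} (p : Subset m) {q r} → q ⊆ r → p ─ r ⊆ p ─ q
  p─-antitone p {q} {r} q⊆r x∈ = SP.x∈p∧x∉q⇒x∈p─q (SP.p─q⊆p p r x∈) (x∈p─q⇒x∉q p r x∈ ∘ q⊆r)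

  p─q-monotone : ∀ {m} {p p′ : Subset m} {q} → p ⊆ p′ → p ─ q ⊆ p′ ─ q
  p─q-monotone {p = p} {p′} {q} p⊆p′ x∈ = SP.x∈p∧x∉q⇒x∈p─q (p⊆p′ (SP.p─q⊆p p q x∈)) (x∈p─q⇒x∉q p q x∈)

  [p─q]∪q≡p : ∀ {m} {p q : Subset m} → q ⊆ p → (p ─ q) ∪ q ≡ p
  [p─q]∪q≡p {p = p} {q} q⊆p = SP.⊆-antisym ⊆p p⊆
    where
    ⊆p : (p ─ q) ∪ q ⊆ p
    ⊆p x∈ = [ SP.p─q⊆p p q , q⊆p ]′ (SP.x∈p∪q⁻ (p ─ q) q x∈)
    p⊆ : p ⊆ (p ─ q) ∪ q
    p⊆ {x} x∈p with x SP.∈? q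
    ... | yes x∈q = SP.x∈p∪q⁺ (inj₂ x∈q)
    ... | no x∉q  = SP.x∈p∪q⁺ (inj₁ (SP.x∈p∧x∉q⇒x∈p─q x∈p x∉q))

  p─[p─q]⊆p∩q : ∀ {m} (p q : Subset m) → p ─ (p ─ q) ⊆ p ∩ q
  p─[p─q]⊆p∩q p q {x} x∈ with x SP.∈? q
  ... | yes x∈q = SP.x∈p∩q⁺ (SP.p─q⊆p p _ x∈ , x∈q)
  ... | no x∉q  = ⊥-elim (x∈p─q⇒x∉q p (p ─ q) x∈ (SP.x∈p∧x∉q⇒x∈p─q (SP.p─q⊆p p _ x∈) x∉q))

  ∣p∩r∣≡∣p∩q∩r∣+∣p─q∩r∣ : ∀ {m} (p q r : Subset m) →
    ∣ p ∩ r ∣ ≡ ∣ (p ∩ q) ∩ r ∣ + ∣ (p ─ q) ∩ r ∣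
  ∣p∩r∣≡∣p∩q∩r∣+∣p─q∩r∣ [] [] [] = refl
  ∣p∩r∣≡∣p∩q∩r∣+∣p─q∩r∣ (inside ∷ p) (inside ∷ q) (inside ∷ r) =
    cong suc (∣p∩r∣≡∣p∩q∩r∣+∣p─q∩r∣ p q r)
  ∣p∩r∣≡∣p∩q∩r∣+∣p─q∩r∣ (inside ∷ p) (outside ∷ q) (inside ∷ r) =
    trans (cong suc (∣p∩r∣≡∣p∩q∩r∣+∣p─q∩r∣ p q r)) (sym (ℕP.+-suc _ _))
  ∣p∩r∣≡∣p∩q∩r∣+∣p─q∩r∣ (inside ∷ p) (inside ∷ q) (outside ∷ r) = ∣p∩r∣≡∣p∩q∩r∣+∣p─q∩r∣ p q r
  ∣p∩r∣≡∣p∩q∩r∣+∣p─q∩r∣ (inside ∷ p) (outside ∷ q) (outside ∷ r) = ∣p∩r∣≡∣p∩q∩r∣+∣p─q∩r∣ p q r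
  ∣p∩r∣≡∣p∩q∩r∣+∣p─q∩r∣ (outside ∷ p) (inside ∷ q) (_ ∷ r) = ∣p∩r∣≡∣p∩q∩r∣+∣p─q∩r∣ p q r
  ∣p∩r∣≡∣p∩q∩r∣+∣p─q∩r∣ (outside ∷ p) (outside ∷ q) (_ ∷ r) = ∣p∩r∣≡∣p∩q∩r∣+∣p─q∩r∣ p q r

  module _ {m : ℕ} {R : Fin m → Fin m → Set} where

    HasClasses-≤ : ∀ {a b} → HasClasses R a → HasClasses R b → a ≤ b
    HasClasses-≤ {a} (f , f-onto , f-classes) (g , _ , g-classes) = FP.injective⇒≤ g∘rep-injective
      where
      rep : Fin a → Fin m
      rep i = proj₁ (f-onto i)
      g∘rep-injective : Injective _≡_ _≡_ (g ∘ rep)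
      g∘rep-injective {i} {j} e = begin
        i             ≡⟨ sym (proj₂ (f-onto i)) ⟩
        f (rep i)     ≡⟨ Equivalence.from (f-classes _ _) (Equivalence.to (g-classes _ _) e) ⟩
        f (rep j)     ≡⟨ proj₂ (f-onto j) ⟩
        j             ∎
        where open ≡-Reasoning

    HasClasses-unique : ∀ {a b} → HasClasses R a → HasClasses R b → a ≡ b
    HasClasses-unique A B = ℕP.≤-antisym (HasClasses-≤ A B) (HasClasses-≤ B A)

    HasClasses-resp-⇔ : ∀ {R′ : Fin m → Fin m → Set} {a} →
      (∀ x y → R x y ⇔ R′ x y) → HasClasses R a → HasClasses R′ a
    HasClasses-resp-⇔ R⇔R′ (f , f-onto , f-classes) =
      f , f-onto , λ x y → mk⇔ (Equivalence.to (R⇔R′ x y) ∘ Equivalence.to (f-classes x y))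
                               (Equivalence.from (f-classes x y) ∘ Equivalence.from (R⇔R′ x y))

    total⇒HasClasses-1 : Fin m → (∀ x y → R x y) → HasClasses R 1
    total⇒HasClasses-1 x total =
      (λ _ → zero) , (λ { zero → x , refl }) , λ y z → mk⇔ (λ _ → total y z) (λ _ → refl)

  module _ {b : ℕ} {i j : Fin (suc b)} (i≢j : i ≢ j) where

    merge : Fin (suc b) → Fin b
    merge k with k ≟ j
    ... | yes _   = punchOut (i≢j ∘ sym)
    ... | no k≢j  = punchOut (k≢j ∘ sym)

    merge-identifies : merge i ≡ merge j
    merge-identifies with i ≟ j | j ≟ j
    ... | yes i≡j | _       = ⊥-elim (i≢j i≡j)
    ... | no _    | yes _   = FP.punchOut-cong j refl
    ... | no _    | no j≢j  = ⊥-elim (j≢j refl)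

    merge-punchIn : ∀ l → merge (punchIn j l) ≡ l
    merge-punchIn l with punchIn j l ≟ j
    ... | yes e = ⊥-elim (FP.punchInᵢ≢i j l e)
    ... | no _  = trans (FP.punchOut-cong j refl) (FP.punchOut-punchIn j)

    merge-≡ : ∀ {k l} → merge k ≡ merge l → k ≡ l ⊎ (k ≡ i × l ≡ j) ⊎ (k ≡ j × l ≡ i)
    merge-≡ {k} {l} e with k ≟ j | l ≟ j
    ... | yes k≡j | yes l≡j = inj₁ (trans k≡j (sym l≡j))
    ... | yes k≡j | no l≢j  = inj₂ (inj₂ (k≡j , sym (FP.punchOut-injective (i≢j ∘ sym) (l≢j ∘ sym) e)))
    ... | no k≢j  | yes l≡j = inj₂ (inj₁ (FP.punchOut-injective (k≢j ∘ sym) (i≢j ∘ sym) e , l≡j))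
    ... | no k≢j  | no l≢j  = inj₁ (FP.punchOut-injective (k≢j ∘ sym) (l≢j ∘ sym) e)

  -- Orbits of an endofunction

  module _ {A : Set} (f : A → A) where

    iter-+ : ∀ k m x → iter f (k + m) x ≡ iter f k (iter f m x)
    iter-+ zero    m x = refl
    iter-+ (suc k) m x = cong f (iter-+ k m x)

    iter-comm : ∀ k x → iter f k (f x) ≡ f (iter f k x)
    iter-comm zero    x = refl
    iter-comm (suc k) x = cong f (iter-comm k x)

    iter-injective : Injective _≡_ _≡_ f → ∀ k → Injective _≡_ _≡_ (iter f k)
    iter-injective f-inj zero    e = e
    iter-injective f-inj (suc k) e = iter-injective f-inj k (f-inj e)

    iter-*-periodic : ∀ {x} d → iter f d x ≡ x → ∀ q → iter f (q * d) x ≡ x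
    iter-*-periodic     d fix zero    = refl
    iter-*-periodic {x} d fix (suc q) = begin
      iter f (d + q * d) x        ≡⟨ iter-+ d (q * d) x ⟩
      iter f d (iter f (q * d) x) ≡⟨ cong (iter f d) (iter-*-periodic d fix q) ⟩
      iter f d x                  ≡⟨ fix ⟩
      x                           ∎
      where open ≡-Reasoning

    iter-%-periodic : ∀ {x} d → iter f (suc d) x ≡ x → ∀ k → iter f (k % suc d) x ≡ iter f k x
    iter-%-periodic {x} d fix k = sym (begin
      iter f k x                                ≡⟨ cong (λ j → iter f j x) (m≡m%n+[m/n]*n k (suc d)) ⟩
      iter f (k % suc d + q * suc d) x          ≡⟨ iter-+ (k % suc d) (q * suc d) x ⟩
      iter f (k % suc d) (iter f (q * suc d) x) ≡⟨ cong (iter f (k % suc d)) (iter-*-periodic (suc d) fix q) ⟩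
      iter f (k % suc d) x                      ∎)
      where
      open ≡-Reasoning
      q : ℕ
      q = k / suc d

    Orbit : A → A → Set
    Orbit x y = ∃[ k ] iter f k x ≡ y

    Orbit-trans : ∀ {x y z} → Orbit x y → Orbit y z → Orbit x z
    Orbit-trans {x} (k , refl) (j , refl) = j + k , iter-+ j k x

  module _ {m : ℕ} {f : Fin m → Fin m} (f-injective : Injective _≡_ _≡_ f) where

    iter-repeat⇒periodic : ∀ {x i j} → i < j → iter f i x ≡ iter f j x →
      ∃[ d ] j ≡ i + suc d × iter f (suc d) x ≡ x
    iter-repeat⇒periodic {x} {i} i<j e with ℕP.m≤n⇒∃[o]m+o≡n i<j
    ... | d , refl = d , sym (ℕP.+-suc i d) , iter-injective f f-injective i (begin
      iter f i (iter f (suc d) x) ≡⟨ iter-+ f i (suc d) x ⟨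
      iter f (i + suc d) x        ≡⟨ cong (λ j → iter f j x) (ℕP.+-suc i d) ⟩
      iter f (suc i + d) x        ≡⟨ e ⟨
      iter f i x                  ∎)
      where open ≡-Reasoning

    iter-periodic : ∀ x → ∃[ d ] iter f (suc d) x ≡ x
    iter-periodic x with FP.pigeonhole (ℕP.n<1+n m) (λ (k : Fin (suc m)) → iter f (toℕ k) x)
    ... | _ , _ , i<j , e with iter-repeat⇒periodic i<j e
    ...   | d , _ , fix = d , fix

    Orbit-sym : ∀ {x y} → Orbit f x y → Orbit f y x
    Orbit-sym {x} (k , refl) with iter-periodic x
    ... | d , fix = k * d , (begin
      iter f (k * d) (iter f k x) ≡⟨ iter-+ f (k * d) k x ⟨
      iter f (k * d + k) x        ≡⟨ cong (λ j → iter f j x) (trans (ℕP.+-comm (k * d) k) (sym (ℕP.*-suc k d))) ⟩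
      iter f (k * suc d) x        ≡⟨ iter-*-periodic f (suc d) fix k ⟩
      x                           ∎)
      where open ≡-Reasoning

    full-orbit⇒period-≥ : ∀ {x} → (∀ y → Orbit f x y) → ∀ d → iter f (suc d) x ≡ x → m ≤ suc d
    full-orbit⇒period-≥ {x} full d fix = FP.injective⇒≤ F-injective
      where
      F : Fin m → Fin (suc d)
      F y = fromℕ< (m%n<n (proj₁ (full y)) (suc d))
      F-injective : Injective _≡_ _≡_ F
      F-injective {y} {z} e = begin
        y                            ≡⟨ proj₂ (full y) ⟨
        iter f k x                   ≡⟨ iter-%-periodic f d fix k ⟨
        iter f (k % suc d) x         ≡⟨ cong (λ j → iter f j x) k≡l ⟩
        iter f (l % suc d) x         ≡⟨ iter-%-periodic f d fix l ⟩
        iter f l x                   ≡⟨ proj₂ (full z) ⟩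
        z                            ∎
        where
        open ≡-Reasoning
        k l : ℕ
        k = proj₁ (full y)
        l = proj₁ (full z)
        k≡l : k % suc d ≡ l % suc d
        k≡l = trans (sym (FP.toℕ-fromℕ< _)) (trans (cong toℕ e) (FP.toℕ-fromℕ< _))

    full-orbit⇒no-repeat : ∀ {x} → (∀ y → Orbit f x y) → ∀ {i j} → i < j → j < m → iter f i x ≢ iter f j x
    full-orbit⇒no-repeat full {i} i<j j<m e with iter-repeat⇒periodic i<j e
    ... | d , refl , fix = ℕP.<-irrefl refl (begin-strict
      m         ≤⟨ full-orbit⇒period-≥ full d fix ⟩
      suc d     ≤⟨ ℕP.m≤n+m (suc d) i ⟩
      i + suc d <⟨ j<m ⟩
      m         ∎)
      where open ℕP.≤-Reasoning

    full-orbit⇒positions-unique : ∀ {x} → (∀ y → Orbit f x y) → ∀ {i j} → i < m → j < m →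
      iter f i x ≡ iter f j x → i ≡ j
    full-orbit⇒positions-unique full {i} {j} i<m j<m e with ℕP.<-cmp i j
    ... | tri< i<j _ _ = ⊥-elim (full-orbit⇒no-repeat full i<j j<m e)
    ... | tri≈ _ i≡j _ = i≡j
    ... | tri> _ _ j<i = ⊥-elim (full-orbit⇒no-repeat full j<i i<m (sym e))

  -- The cyclic order on Fin (suc k), and lists read as cycles

  cnext-toℕ : ∀ {k} (i : Fin (suc k)) → toℕ i < k → toℕ (cnext i) ≡ suc (toℕ i)
  cnext-toℕ {k} i i<k = begin
    toℕ (cnext i)          ≡⟨ FP.toℕ-fromℕ< _ ⟩
    (toℕ i + 1) % suc k    ≡⟨ cong (_% suc k) (ℕP.+-comm (toℕ i) 1) ⟩
    suc (toℕ i) % suc k    ≡⟨ m<n⇒m%n≡m (s≤s i<k) ⟩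
    suc (toℕ i)            ∎
    where open ≡-Reasoning

  cnext-last : ∀ {k} (i : Fin (suc k)) → toℕ i ≡ k → cnext i ≡ zero
  cnext-last {k} i i≡k = FP.toℕ-injective (begin
    toℕ (cnext i)          ≡⟨ FP.toℕ-fromℕ< _ ⟩
    (toℕ i + 1) % suc k    ≡⟨ cong (λ m → (m + 1) % suc k) i≡k ⟩
    (k + 1) % suc k        ≡⟨ cong (_% suc k) (ℕP.+-comm k 1) ⟩
    suc k % suc k          ≡⟨ n%n≡0 (suc k) ⟩
    0                      ∎)
    where open ≡-Reasoning

  cnext-cases : ∀ {k} (i : Fin (suc k)) →
    (toℕ i < k × toℕ (cnext i) ≡ suc (toℕ i)) ⊎ (toℕ i ≡ k × cnext i ≡ zero)
  cnext-cases {k} i with ℕP.m≤n⇒m<n∨m≡n (FP.toℕ≤pred[n] i)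
  ... | inj₁ i<k = inj₁ (i<k , cnext-toℕ i i<k)
  ... | inj₂ i≡k = inj₂ (i≡k , cnext-last i i≡k)

  cnext-suc : ∀ {k} (i : Fin (suc k)) → cnext i ≢ zero → toℕ (cnext i) ≡ suc (toℕ i)
  cnext-suc i next≢0 with cnext-cases i
  ... | inj₁ (_ , next) = next
  ... | inj₂ (_ , next≡0) = ⊥-elim (next≢0 next≡0)

  module _ {k : ℕ} {A : Set} {R : A → A → Set} (f : Fin (suc k) → A) (i : Fin (suc k))
           (step : ∀ j → j ≢ i → Star R (f j) (f (cnext j))) where

    cnext-segment : ∀ d {j b} → toℕ j + d ≡ toℕ b →
      (∀ j′ → toℕ j ≤ toℕ j′ → toℕ j′ < toℕ b → j′ ≢ i) → Star R (f j) (f b)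
    cnext-segment zero {j} e _ rewrite FP.toℕ-injective (trans (sym (ℕP.+-identityʳ (toℕ j))) e) = ε
    cnext-segment (suc d) {j} {b} e avoid =
      step j (avoid j ℕP.≤-refl j<b) ◅◅ cnext-segment d e′ avoid′
      where
      j<b : toℕ j < toℕ b
      j<b = subst (toℕ j <_) e (ℕP.m<m+n (toℕ j) (s≤s z≤n))
      next : toℕ (cnext j) ≡ suc (toℕ j)
      next = cnext-toℕ j (ℕP.<-≤-trans j<b (FP.toℕ≤pred[n] b))
      e′ : toℕ (cnext j) + d ≡ toℕ b
      e′ = trans (cong (_+ d) next) (trans (sym (ℕP.+-suc (toℕ j) d)) e)
      avoid′ : ∀ j′ → toℕ (cnext j) ≤ toℕ j′ → toℕ j′ < toℕ b → j′ ≢ i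
      avoid′ j′ le = avoid j′ (ℕP.≤-trans (ℕP.n≤1+n (toℕ j)) (subst (_≤ toℕ j′) next le))

    private
      below-i : ∀ {j} (j′ : Fin (suc k)) → toℕ {suc k} j ≤ toℕ j′ → toℕ j′ < toℕ i → j′ ≢ i
      below-i j′ _ j′<i refl = ℕP.<-irrefl refl j′<i

    cnext-reaches : ∀ j → Star R (f j) (f i)
    cnext-reaches j with toℕ j ℕP.≤? toℕ i
    ... | yes j≤i = cnext-segment _ (ℕP.m+[n∸m]≡n j≤i) below-i
    ... | no j≰i = cnext-segment _ (trans (ℕP.m+[n∸m]≡n (FP.toℕ≤pred[n] j)) (sym (FP.toℕ-fromℕ k))) above-i
          ◅◅ subst (Star R (f last) ∘ f) (cnext-last last (FP.toℕ-fromℕ k)) (step last last≢i)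
          ◅◅ cnext-segment (toℕ i) {zero} refl below-i
      where
      last : Fin (suc k)
      last = fromℕ k
      i<j : toℕ i < toℕ j
      i<j = ℕP.≰⇒> j≰i
      above-i : ∀ j′ → toℕ j ≤ toℕ j′ → toℕ j′ < toℕ last → j′ ≢ i
      above-i j′ j≤j′ _ refl = ℕP.<-irrefl refl (ℕP.<-≤-trans i<j j≤j′)
      last≢i : last ≢ i
      last≢i refl = ℕP.<-irrefl (FP.toℕ-fromℕ k) (ℕP.<-≤-trans i<j (FP.toℕ≤pred[n] j))

  module _ {A : Set} where

    nth : A → List A → ℕ → A
    nth d []       _       = d
    nth d (x ∷ xs) zero    = x
    nth d (x ∷ xs) (suc k) = nth d xs k

    lookup≡nth : ∀ d (xs : List A) i → lookup xs i ≡ nth d xs (toℕ i)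
    lookup≡nth d (x ∷ xs) zero    = refl
    lookup≡nth d (x ∷ xs) (suc i) = lookup≡nth d xs i

    nth-length : ∀ d (xs : List A) → nth d xs (length xs) ≡ d
    nth-length d []       = refl
    nth-length d (x ∷ xs) = nth-length d xs

    lookup-injective-on : ∀ {B : Set} (F : A → B) {xs} → AllPairs (λ a b → F a ≢ F b) xs →
      ∀ i j → F (lookup xs i) ≡ F (lookup xs j) → i ≡ j
    lookup-injective-on F (_  ∷ _)   zero    zero    _ = refl
    lookup-injective-on F (F≢ ∷ _)   zero    (suc j) e = ⊥-elim (All.lookup F≢ (∈-lookup j) e)
    lookup-injective-on F (F≢ ∷ _)   (suc i) zero    e = ⊥-elim (All.lookup F≢ (∈-lookup i) (sym e))
    lookup-injective-on F (_  ∷ F≢s) (suc i) (suc j) e = cong suc (lookup-injective-on F F≢s i j e)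

  -- Connectivity in a combinatorial map

  module _ {n : ℕ} (M : RootedMap n) where
    open RootedMap M

    α⁺ σ⁺ σ⁻ : Fin n → Fin n
    α⁺ = αf M
    σ⁺ = σf M
    σ⁻ h = σ ⟨$⟩ˡ h

    α-injective : Injective _≡_ _≡_ α⁺
    α-injective {h} {h′} e = trans (sym (α-invol h)) (trans (cong α⁺ e) (α-invol h′))

    σ-injective : Injective _≡_ _≡_ σ⁺
    σ-injective {h} {h′} e = trans (sym (inverseˡ σ)) (trans (cong σ⁻ e) (inverseˡ σ))

    ∈edge⁻ : ∀ {x} g → x ∈ edge M g → x ≡ g ⊎ x ≡ α⁺ g
    ∈edge⁻ g x∈ with SP.x∈p∪q⁻ ⁅ g ⁆ ⁅ α⁺ g ⁆ x∈
    ... | inj₁ x∈g  = inj₁ (SP.x∈⁅y⁆⇒x≡y g x∈g)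
    ... | inj₂ x∈αg = inj₂ (SP.x∈⁅y⁆⇒x≡y (α⁺ g) x∈αg)

    g∈edge : ∀ g → g ∈ edge M g
    g∈edge g = SP.x∈p∪q⁺ (inj₁ (SP.x∈⁅x⁆ g))

    αg∈edge : ∀ g → α⁺ g ∈ edge M g
    αg∈edge g = SP.x∈p∪q⁺ (inj₂ (SP.x∈⁅x⁆ (α⁺ g)))

    edge⊆ : ∀ {X g} → EdgeSet M X → g ∈ X → edge M g ⊆ X
    edge⊆ {X} {g} eX g∈X x∈ with ∈edge⁻ g x∈
    ... | inj₁ refl = g∈X
    ... | inj₂ refl = eX g g∈X

    edge-α : ∀ g → edge M (α⁺ g) ≡ edge M g
    edge-α g = trans (cong (λ h → ⁅ α⁺ g ⁆ ∪ ⁅ h ⁆) (α-invol g)) (SP.∪-comm ⁅ α⁺ g ⁆ ⁅ g ⁆)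

    ∈edge⇒edge≡ : ∀ {x g} → x ∈ edge M g → edge M x ≡ edge M g
    ∈edge⇒edge≡ {g = g} x∈g with ∈edge⁻ g x∈g
    ... | inj₁ refl = refl
    ... | inj₂ refl = edge-α g

    EdgeSet-edge : ∀ g → EdgeSet M (edge M g)
    EdgeSet-edge g h h∈ with ∈edge⁻ g h∈
    ... | inj₁ refl = αg∈edge h
    ... | inj₂ refl = subst (_∈ edge M g) (sym (α-invol g)) (g∈edge g)

    EdgeSet-∩ : ∀ {X Y} → EdgeSet M X → EdgeSet M Y → EdgeSet M (X ∩ Y)
    EdgeSet-∩ {X} {Y} eX eY h h∈ with SP.x∈p∩q⁻ X Y h∈
    ... | h∈X , h∈Y = SP.x∈p∩q⁺ (eX h h∈X , eY h h∈Y)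

    EdgeSet-─ : ∀ {X Y} → EdgeSet M X → EdgeSet M Y → EdgeSet M (X ─ Y)
    EdgeSet-─ {X} {Y} eX eY h h∈ =
      SP.x∈p∧x∉q⇒x∈p─q (eX h (SP.p─q⊆p X Y h∈))
                       (λ αh∈Y → x∈p─q⇒x∉q X Y h∈ (subst (_∈ Y) (α-invol h) (eY _ αh∈Y)))

    EdgeSet-∪ : ∀ {X Y} → EdgeSet M X → EdgeSet M Y → EdgeSet M (X ∪ Y)
    EdgeSet-∪ {X} {Y} eX eY h h∈ with SP.x∈p∪q⁻ X Y h∈
    ... | inj₁ h∈X = SP.x∈p∪q⁺ (inj₁ (eX h h∈X))
    ... | inj₂ h∈Y = SP.x∈p∪q⁺ (inj₂ (eY h h∈Y))

    Connected-reroute : ∀ {X Y} → (∀ {h} → h ∈ X → Connected M Y h (α⁺ h)) →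
      ∀ {a b} → Connected M X a b → Connected M Y a b
    Connected-reroute {X} {Y} via = reroute ⋆
      where
      reroute : ∀ {a b} → CompStep M X a b → Connected M Y a b
      reroute (around h)    = around h ◅ ε
      reroute (around⁻ h)   = around⁻ h ◅ ε
      reroute (cross h h∈X) = via h∈X

    Connected-mono : ∀ {X Y} → X ⊆ Y → ∀ {a b} → Connected M X a b → Connected M Y a b
    Connected-mono X⊆Y = Connected-reroute (λ h∈X → cross _ (X⊆Y h∈X) ◅ ε)

    Connected-sym : ∀ {X} → EdgeSet M X → ∀ {a b} → Connected M X a b → Connected M X b a
    Connected-sym {X} eX = Star.concat ∘ Star.reverse step-back
      where
      step-back : ∀ {a b} → CompStep M X a b → Connected M X b a
      step-back (around h)    = subst (Connected M X (σ⁺ h)) (inverseˡ σ) (around⁻ (σ⁺ h) ◅ ε)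
      step-back (around⁻ h)   = subst (Connected M X (σ⁻ h)) (inverseʳ σ) (around (σ⁻ h) ◅ ε)
      step-back (cross h h∈X) = subst (Connected M X (α⁺ h)) (α-invol h) (cross (α⁺ h) (eX h h∈X) ◅ ε)

    SameVertex⇒Connected : ∀ {X a b} → SameVertex M a b → Connected M X a b
    SameVertex⇒Connected {X} {a} (k , refl) = go k
      where
      go : ∀ k → Connected M X a (iter σ⁺ k a)
      go zero    = ε
      go (suc k) = go k ◅◅ (around _ ◅ ε)

    Connected-invariant : ∀ {B : Set} {X} (F : Fin n → B) → (∀ {x y} → CompStep M X x y → F x ≡ F y) →
      ∀ {a b} → Connected M X a b → F a ≡ F b
    Connected-invariant F F-step = Star.fold (λ a b → F a ≡ F b) (trans ∘ F-step) refl

    HasClasses-∪edge : ∀ {X g a} → HasClasses (Connected M X) a → ¬ Connected M X g (α⁺ g) →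
      ∃[ b ] a ≡ suc b × HasClasses (Connected M (X ∪ edge M g)) b
    HasClasses-∪edge {g = g} {zero} (f , _) _ = ⊥-elim (FP.¬Fin0 (f g))
    HasClasses-∪edge {X} {g} {suc b} (f , f-onto , f-classes) g↛αg =
      b , refl , merge i≢j ∘ f , onto ,
      λ h h′ → mk⇔ (classes⇒connected h h′) (Connected-invariant (merge i≢j ∘ f) step)
      where
      X′ : Subset n
      X′ = X ∪ edge M g
      i≢j : f g ≢ f (α⁺ g)
      i≢j = g↛αg ∘ Equivalence.to (f-classes _ _)
      ~X : ∀ {h h′} → f h ≡ f h′ → Connected M X′ h h′
      ~X = Connected-mono (SP.p⊆p∪q (edge M g)) ∘ Equivalence.to (f-classes _ _)
      onto : ∀ l → ∃[ h ] merge i≢j (f h) ≡ l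
      onto l with f-onto (punchIn (f (α⁺ g)) l)
      ... | h , fh≡ = h , trans (cong (merge i≢j) fh≡) (merge-punchIn i≢j l)
      classes⇒connected : ∀ h h′ → merge i≢j (f h) ≡ merge i≢j (f h′) → Connected M X′ h h′
      classes⇒connected h h′ e with merge-≡ i≢j e
      ... | inj₁ fh≡fh′               = ~X fh≡fh′
      ... | inj₂ (inj₁ (fh≡i , fh′≡j)) = ~X fh≡i ◅◅ cross g (SP.x∈p∪q⁺ (inj₂ (g∈edge g))) ◅ ~X (sym fh′≡j)
      ... | inj₂ (inj₂ (fh≡j , fh′≡i)) = ~X fh≡j ◅◅ cross (α⁺ g) (SP.x∈p∪q⁺ (inj₂ (αg∈edge g))) ◅
                                           ~X (trans (cong f (α-invol g)) (sym fh′≡i))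
      step : ∀ {x y} → CompStep M X′ x y → merge i≢j (f x) ≡ merge i≢j (f y)
      step (around h)  = cong (merge i≢j) (Equivalence.from (f-classes _ _) (around h ◅ ε))
      step (around⁻ h) = cong (merge i≢j) (Equivalence.from (f-classes _ _) (around⁻ h ◅ ε))
      step (cross h h∈) with SP.x∈p∪q⁻ X (edge M g) h∈
      ... | inj₁ h∈X = cong (merge i≢j) (Equivalence.from (f-classes _ _) (cross h h∈X ◅ ε))
      ... | inj₂ h∈g with ∈edge⁻ g h∈g
      ...   | inj₁ refl = merge-identifies i≢j
      ...   | inj₂ refl = trans (sym (merge-identifies i≢j)) (cong (merge i≢j ∘ f) (sym (α-invol g)))

    Via : Subset n → Fin n → Fin n → Fin n → Set
    Via W g x y = (Connected M W x g × Connected M W (α⁺ g) y) ⊎ (Connected M W x (α⁺ g) × Connected M W g y)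

    prepend-Via : ∀ {W g x x′ y} → Connected M W x x′ →
      Connected M W x′ y ⊎ Via W g x′ y → Connected M W x y ⊎ Via W g x y
    prepend-Via p (inj₁ q)              = inj₁ (p ◅◅ q)
    prepend-Via p (inj₂ (inj₁ (q , r))) = inj₂ (inj₁ (p ◅◅ q , r))
    prepend-Via p (inj₂ (inj₂ (q , r))) = inj₂ (inj₂ (p ◅◅ q , r))

    Connected-∪edge⇒Via : ∀ {W g x y} → Connected M (W ∪ edge M g) x y → Connected M W x y ⊎ Via W g x y
    Connected-∪edge⇒Via ε = inj₁ ε
    Connected-∪edge⇒Via (around h ◅ p)  = prepend-Via (around h ◅ ε) (Connected-∪edge⇒Via p)
    Connected-∪edge⇒Via (around⁻ h ◅ p) = prepend-Via (around⁻ h ◅ ε) (Connected-∪edge⇒Via p)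
    Connected-∪edge⇒Via {W} {g} (cross h h∈ ◅ p) with SP.x∈p∪q⁻ W (edge M g) h∈
    ... | inj₁ h∈W = prepend-Via (cross h h∈W ◅ ε) (Connected-∪edge⇒Via p)
    ... | inj₂ h∈g with ∈edge⁻ g h∈g
    ...   | inj₁ refl = from-g (Connected-∪edge⇒Via p)
      where
      from-g : ∀ {y} → Connected M W (α⁺ g) y ⊎ Via W g (α⁺ g) y → Connected M W g y ⊎ Via W g g y
      from-g (inj₁ αg→y)              = inj₂ (inj₁ (ε , αg→y))
      from-g (inj₂ (inj₁ (_ , αg→y))) = inj₂ (inj₁ (ε , αg→y))
      from-g (inj₂ (inj₂ (_ , g→y)))  = inj₁ g→y
    ...   | inj₂ refl =
      from-αg (subst (λ z → Connected M W z _ ⊎ Via W g z _) (α-invol g) (Connected-∪edge⇒Via p))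
      where
      from-αg : ∀ {y} → Connected M W g y ⊎ Via W g g y → Connected M W (α⁺ g) y ⊎ Via W g (α⁺ g) y
      from-αg (inj₁ g→y)               = inj₂ (inj₂ (ε , g→y))
      from-αg (inj₂ (inj₁ (_ , αg→y))) = inj₁ αg→y
      from-αg (inj₂ (inj₂ (_ , g→y)))  = inj₂ (inj₂ (ε , g→y))

    Via-mono : ∀ {W W′ g x y} → W ⊆ W′ → Via W g x y → Via W′ g x y
    Via-mono W⊆W′ = Sum.map (Product.map (Connected-mono W⊆W′) (Connected-mono W⊆W′))
                            (Product.map (Connected-mono W⊆W′) (Connected-mono W⊆W′))

    edge-induction : (P : Subset n → Set) → P ⊥ →
      (∀ {X g} → EdgeSet M X → g ∈ X → P (X ─ edge M g) → P X) → ∀ {X} → EdgeSet M X → P X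
    edge-induction P base step {X} = go (suc ∣ X ∣) X ℕP.≤-refl
      where
      go : ∀ k X → ∣ X ∣ < k → EdgeSet M X → P X
      go (suc k) X ∣X∣≤k eX with SP.nonempty? X
      ... | no X-empty    = subst P (sym (SP.Empty-unique X-empty)) base
      ... | yes (g , g∈X) = step eX g∈X (go k (X ─ edge M g) smaller (EdgeSet-─ eX (EdgeSet-edge g)))
        where
        smaller : ∣ X ─ edge M g ∣ < k
        smaller = ℕP.<-≤-trans (SP.p∩q≢∅⇒∣p─q∣<∣p∣ X (edge M g) (g , SP.x∈p∩q⁺ (g∈X , g∈edge g)))
                               (s≤s⁻¹ ∣X∣≤k)

    Connected⇒avoids-or-Via : ∀ {T X x y} → EdgeSet M X → X ⊆ T → Connected M T x y →
      Connected M (T ─ X) x y ⊎ ∃[ d ] d ∈ X × Via (T ─ edge M d) d x y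
    Connected⇒avoids-or-Via {T} {x = x} {y} eX X⊆T x→y = edge-induction P base step eX X⊆T
      where
      P : Subset n → Set
      P X = X ⊆ T → Connected M (T ─ X) x y ⊎ ∃[ d ] d ∈ X × Via (T ─ edge M d) d x y
      base : P ⊥
      base _ = inj₁ (subst (λ Z → Connected M Z x y) (sym (SP.p─⊥≡p T)) x→y)
      step : ∀ {X g} → EdgeSet M X → g ∈ X → P (X ─ edge M g) → P X
      step {X} {g} eX g∈X IH X⊆T with IH (X⊆T ∘ SP.p─q⊆p X (edge M g))
      ... | inj₂ (d , d∈ , via) = inj₂ (d , SP.p─q⊆p X (edge M g) d∈ , via)
      ... | inj₁ x→y with Connected-∪edge⇒Via (Connected-mono (p─[q─r]⊆[p─q]∪r T X (edge M g)) x→y)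
      ...   | inj₁ x→y′ = inj₁ x→y′
      ...   | inj₂ via  = inj₂ (g , g∈X , Via-mono (p─-antitone T (edge⊆ eX g∈X)) via)

    Cycle-restrict : ∀ {X Y} (C : Cycle M X) → (∀ i → Cycle.hs C i ∈ Y) → Cycle M Y
    Cycle-restrict C inY = record
      { len = len ; hs = hs ; inS = inY ; distinctEdges = distinctEdges
      ; distinctVertices = distinctVertices ; chained = chained }
      where open Cycle C

    Cycle-edge-not-bridge : ∀ {X} (C : Cycle M X) i →
      let open Cycle C in Connected M (X ─ edge M (hs i)) (α⁺ (hs i)) (hs i)
    Cycle-edge-not-bridge {X} C i =
      SameVertex⇒Connected (chained i) ◅◅ cnext-reaches hs i around-the-cycle (cnext i)
      where
      open Cycle C
      around-the-cycle : ∀ j → j ≢ i → Connected M (X ─ edge M (hs i)) (hs j) (hs (cnext j))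
      around-the-cycle j j≢i = cross (hs j) hsj∈ ◅ SameVertex⇒Connected (chained j)
        where
        hsj∈ : hs j ∈ X ─ edge M (hs i)
        hsj∈ = SP.x∈p∧x∉q⇒x∈p─q (inS j) λ hsj∈i →
          [ proj₁ (distinctEdges j i j≢i) , proj₂ (distinctEdges j i j≢i) ]′ (∈edge⁻ (hs i) hsj∈i)

    acyclic-∪edge : ∀ {Y a} → EdgeSet M Y → ¬ Cycle M Y → ¬ Connected M Y a (α⁺ a) → ¬ Cycle M (Y ∪ edge M a)
    acyclic-∪edge {Y} {a} eY acyclic a↛αa C with FP.any? (λ i → Cycle.hs C i SP.∈? edge M a)
    ... | yes (i , hsi∈a) = a↛αa (joins (∈edge⁻ a hsi∈a) (Connected-mono ⊆Y (Cycle-edge-not-bridge C i)))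
      where
      open Cycle C
      ⊆Y : (Y ∪ edge M a) ─ edge M (hs i) ⊆ Y
      ⊆Y x∈ with SP.x∈p∪q⁻ Y (edge M a) (SP.p─q⊆p _ _ x∈)
      ... | inj₁ x∈Y = x∈Y
      ... | inj₂ x∈a = ⊥-elim (x∈p─q⇒x∉q _ (edge M (hs i)) x∈ (subst (_ ∈_) (sym (∈edge⇒edge≡ hsi∈a)) x∈a))
      joins : ∀ {x} → x ≡ a ⊎ x ≡ α⁺ a → Connected M Y (α⁺ x) x → Connected M Y a (α⁺ a)
      joins (inj₁ refl) αa→a  = Connected-sym eY αa→a
      joins (inj₂ refl) ααa→αa = subst (λ z → Connected M Y z (α⁺ a)) (α-invol a) ααa→αa
    ... | no none∈a = acyclic (Cycle-restrict C inY)
      where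
      open Cycle C
      inY : ∀ i → hs i ∈ Y
      inY i with SP.x∈p∪q⁻ Y (edge M a) (inS i)
      ... | inj₁ hsi∈Y = hsi∈Y
      ... | inj₂ hsi∈a = ⊥-elim (none∈a (i , hsi∈a))

    Cycle-mono : ∀ {X Y} → X ⊆ Y → Cycle M X → Cycle M Y
    Cycle-mono X⊆Y C = Cycle-restrict C (X⊆Y ∘ Cycle.inS C)

    exchange-IsSpanningTree : ∀ {T d a} → IsSpanningTree M T →
      ¬ Connected M (T ─ edge M d) a (α⁺ a) → Connected M ((T ─ edge M d) ∪ edge M a) d (α⁺ d) →
      IsSpanningTree M ((T ─ edge M d) ∪ edge M a)
    exchange-IsSpanningTree {T} {d} {a} (eT , connected , acyclic) a↛αa d→αd =
      eT′ , (λ h h′ → Connected-reroute through-T′ (connected h h′)) ,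
      acyclic-∪edge eT─d (acyclic ∘ Cycle-mono (SP.p─q⊆p T (edge M d))) a↛αa
      where
      T′ : Subset n
      T′ = (T ─ edge M d) ∪ edge M a
      eT─d : EdgeSet M (T ─ edge M d)
      eT─d = EdgeSet-─ eT (EdgeSet-edge d)
      eT′ : EdgeSet M T′
      eT′ = EdgeSet-∪ eT─d (EdgeSet-edge a)
      through-T′ : ∀ {h} → h ∈ T → Connected M T′ h (α⁺ h)
      through-T′ {h} h∈T with h SP.∈? edge M d
      ... | no h∉d = cross h (SP.x∈p∪q⁺ (inj₁ (SP.x∈p∧x∉q⇒x∈p─q h∈T h∉d))) ◅ ε
      ... | yes h∈d with ∈edge⁻ d h∈d
      ...   | inj₁ refl = d→αd
      ...   | inj₂ refl = subst (Connected M T′ (α⁺ d)) (sym (α-invol d)) (Connected-sym eT′ d→αd)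

    -- Counting edges
    ∈canon⁺ : ∀ {h} → toℕ h < toℕ (α⁺ h) → h ∈ canon M
    ∈canon⁺ {h} h<αh =
      VP.lookup⇒[]= h (canon M) (trans (VP.lookup∘tabulate _ h) (dec-true (_ ℕP.<? _) h<αh))

    ∈canon⁻ : ∀ {h} → h ∈ canon M → toℕ h < toℕ (α⁺ h)
    ∈canon⁻ {h} h∈ = decidable-stable (_ ℕP.<? _) λ h≮αh →
      case trans (sym (VP.[]=⇒lookup h∈)) (trans (VP.lookup∘tabulate _ h) (dec-false (_ ℕP.<? _) h≮αh)) of λ ()

    #E-canonical-edge : ∀ {g} → toℕ g < toℕ (α⁺ g) → #E M (edge M g) ≡ 1
    #E-canonical-edge {g} g<αg = trans (cong ∣_∣ (SP.⊆-antisym ⊆⁅g⁆ ⁅g⁆⊆)) (SP.∣⁅x⁆∣≡1 g)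
      where
      ⊆⁅g⁆ : edge M g ∩ canon M ⊆ ⁅ g ⁆
      ⊆⁅g⁆ {x} x∈ with SP.x∈p∩q⁻ (edge M g) (canon M) x∈
      ... | x∈g , x∈canon with ∈edge⁻ g x∈g
      ...   | inj₁ refl = SP.x∈⁅x⁆ g
      ...   | inj₂ refl =
        ⊥-elim (ℕP.<-asym g<αg (subst (λ h → toℕ (α⁺ g) < toℕ h) (α-invol g) (∈canon⁻ x∈canon)))
      ⁅g⁆⊆ : ⁅ g ⁆ ⊆ edge M g ∩ canon M
      ⁅g⁆⊆ x∈ rewrite SP.x∈⁅y⁆⇒x≡y g x∈ = SP.x∈p∩q⁺ (g∈edge g , ∈canon⁺ g<αg)

    #E-edge : ∀ g → #E M (edge M g) ≡ 1
    #E-edge g with toℕ g ℕP.<? toℕ (α⁺ g)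
    ... | yes g<αg = #E-canonical-edge g<αg
    ... | no g≮αg = trans (cong (#E M) (sym (edge-α g))) (#E-canonical-edge αg<ααg)
      where
      αg<ααg : toℕ (α⁺ g) < toℕ (α⁺ (α⁺ g))
      αg<ααg = subst (λ h → toℕ (α⁺ g) < toℕ h) (sym (α-invol g))
                 (ℕP.≤∧≢⇒< (ℕP.≮⇒≥ g≮αg) (λ e → α-fpf g (FP.toℕ-injective e)))

    #E-⊥ : #E M ⊥ ≡ 0
    #E-⊥ = trans (cong ∣_∣ (SP.∩-zeroˡ (canon M))) (SP.∣⊥∣≡0 n)

    #E-split : ∀ X Y → #E M X ≡ #E M (X ∩ Y) + #E M (X ─ Y)
    #E-split X Y = ∣p∩r∣≡∣p∩q∩r∣+∣p─q∩r∣ X Y (canon M)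

    #E-remove-edge : ∀ {X g} → EdgeSet M X → g ∈ X → #E M X ≡ suc (#E M (X ─ edge M g))
    #E-remove-edge {X} {g} eX g∈X = begin
      #E M X                                        ≡⟨ #E-split X (edge M g) ⟩
      #E M (X ∩ edge M g) + #E M (X ─ edge M g)     ≡⟨ cong (λ Y → #E M Y + #E M (X ─ edge M g)) X∩g≡g ⟩
      #E M (edge M g) + #E M (X ─ edge M g)         ≡⟨ cong (_+ #E M (X ─ edge M g)) (#E-edge g) ⟩
      suc (#E M (X ─ edge M g))                     ∎
      where
      open ≡-Reasoning
      X∩g≡g : X ∩ edge M g ≡ edge M g
      X∩g≡g = SP.⊆-antisym (SP.p∩q⊆q X (edge M g)) (λ x∈g → SP.x∈p∩q⁺ (edge⊆ eX g∈X x∈g , x∈g))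

    -- Forests: bridges and component counts

    module _ {v : ℕ} (NV : NumVertices M v) where

      vertex : Fin n → Fin v
      vertex = proj₁ NV

      vertex-≡⇒SameVertex : ∀ {a b} → vertex a ≡ vertex b → SameVertex M a b
      vertex-≡⇒SameVertex = Equivalence.to (proj₂ (proj₂ NV) _ _)

      SameVertex⇒vertex-≡ : ∀ {a b} → SameVertex M a b → vertex a ≡ vertex b
      SameVertex⇒vertex-≡ = Equivalence.from (proj₂ (proj₂ NV) _ _)

      -- A walk from vertex x to vertex w that crosses each r ∈ rs from α r to r; rs lists the last step first.
      data Walk (Y : Subset n) (x : Fin v) : Fin v → List (Fin n) → Set where
        []   : Walk Y x x []
        snoc : ∀ {w rs} → Walk Y x w rs → ∀ r → r ∈ Y → vertex (α⁺ r) ≡ w → Walk Y x (vertex r) (r ∷ rs)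

      Walk-∈ : ∀ {Y x w rs} → Walk Y x w rs → All (_∈ Y) rs
      Walk-∈ []               = []
      Walk-∈ (snoc p _ r∈Y _) = r∈Y ∷ Walk-∈ p

      Walk-chain : ∀ {Y l₀ w rs} → Walk Y (vertex l₀) w rs → ∀ {a} → vertex (α⁺ a) ≡ w →
        ∀ i → vertex (α⁺ (lookup (a ∷ rs) i)) ≡ vertex (nth l₀ rs (toℕ i))
      Walk-chain []                 αa≡w zero    = αa≡w
      Walk-chain (snoc p r _ _)     αa≡w zero    = αa≡w
      Walk-chain (snoc p r _ αr≡w′) _    (suc i) = Walk-chain p αr≡w′ i

      record SimpleWalk (Y : Subset n) (x w : Fin v) : Set where
        field
          steps    : List (Fin n)
          walk     : Walk Y x w steps
          avoids-x : All (λ r → vertex r ≢ x) steps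
          distinct : AllPairs (λ r r′ → vertex r ≢ vertex r′) steps

      Walk-prefix-or-avoids : ∀ {Y x w rs} → Walk Y x w rs → All (λ r → vertex r ≢ x) rs →
        AllPairs (λ r r′ → vertex r ≢ vertex r′) rs →
        ∀ u → SimpleWalk Y x u ⊎ (u ≢ x × All (λ r → u ≢ vertex r) rs)
      Walk-prefix-or-avoids {x = x} [] [] [] u with u ≟ x
      ... | yes refl = inj₁ (record { steps = [] ; walk = [] ; avoids-x = [] ; distinct = [] })
      ... | no u≢x   = inj₂ (u≢x , [])
      Walk-prefix-or-avoids (snoc p r r∈Y e) (r≢x ∷ avoids) (r≢rs ∷ distinct) u with u ≟ vertex r
      ... | yes refl = inj₁ (record
        { steps = r ∷ _ ; walk = snoc p r r∈Y e ; avoids-x = r≢x ∷ avoids ; distinct = r≢rs ∷ distinct })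
      ... | no u≢r with Walk-prefix-or-avoids p avoids distinct u
      ...   | inj₁ prefix          = inj₁ prefix
      ...   | inj₂ (u≢x , u∉walk)  = inj₂ (u≢x , u≢r ∷ u∉walk)

      SimpleWalk-extend : ∀ {Y x w} → SimpleWalk Y x w → ∀ r → r ∈ Y → vertex (α⁺ r) ≡ w →
        SimpleWalk Y x (vertex r)
      SimpleWalk-extend {Y} {x} W r r∈Y e =
        [ id , append ]′ (Walk-prefix-or-avoids walk avoids-x distinct (vertex r))
        where
        open SimpleWalk W
        append : vertex r ≢ x × All (λ r′ → vertex r ≢ vertex r′) steps → SimpleWalk Y x (vertex r)
        append (r≢x , r∉walk) = record
          { steps = r ∷ steps ; walk = snoc walk r r∈Y e
          ; avoids-x = r≢x ∷ avoids-x ; distinct = r∉walk ∷ distinct }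

      Connected⇒SimpleWalk : ∀ {Y a b} → EdgeSet M Y → Connected M Y a b → SimpleWalk Y (vertex a) (vertex b)
      Connected⇒SimpleWalk {Y} eY = Star.foldl (λ a b → SimpleWalk Y (vertex a) (vertex b)) extend
        (record { steps = [] ; walk = [] ; avoids-x = [] ; distinct = [] })
        where
        extend : ∀ {a b c} → SimpleWalk Y (vertex a) (vertex b) → CompStep M Y b c →
          SimpleWalk Y (vertex a) (vertex c)
        extend W (around h)    = subst (SimpleWalk Y _) (SameVertex⇒vertex-≡ (1 , refl)) W
        extend W (around⁻ h)   = subst (SimpleWalk Y _) (sym (SameVertex⇒vertex-≡ (1 , inverseʳ σ))) W
        extend W (cross h h∈Y) = SimpleWalk-extend W (α⁺ h) (eY h h∈Y) (cong vertex (α-invol h))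

      SimpleWalk-closing⇒Cycle : ∀ {X Y l₀} → Y ⊆ X → l₀ ∈ X → (W : SimpleWalk Y (vertex l₀) (vertex (α⁺ l₀))) →
        All (λ r → l₀ ≢ α⁺ r) (SimpleWalk.steps W) → Cycle M X
      SimpleWalk-closing⇒Cycle {X} {Y} {l₀} Y⊆X l₀∈X W l₀≢αrs = record
        { len              = length steps
        ; hs               = hs
        ; inS              = λ i → All.lookup (l₀∈X ∷ All.map Y⊆X (Walk-∈ walk)) (∈-lookup i)
        ; distinctEdges    = λ i j i≢j → (λ e → i≢j (vertex-injective i j (cong vertex e))) , not-reversed i j i≢j
        ; distinctVertices = λ i j i≢j sv → i≢j (vertex-injective i j (SameVertex⇒vertex-≡ sv))
        ; chained          = λ i → vertex-≡⇒SameVertex (chained i)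
        }
        where
        open SimpleWalk W
        hs : Fin (suc (length steps)) → Fin n
        hs = lookup (l₀ ∷ steps)

        vertex-injective : ∀ i j → vertex (hs i) ≡ vertex (hs j) → i ≡ j
        vertex-injective = lookup-injective-on vertex (All.map (_∘ sym) avoids-x ∷ distinct)

        chained : ∀ i → vertex (α⁺ (hs i)) ≡ vertex (hs (cnext i))
        chained i = trans (Walk-chain walk refl i) (cong vertex (sym next))
          where
          next : hs (cnext i) ≡ nth l₀ steps (toℕ i)
          next with cnext-cases i
          ... | inj₁ (_ , next≡1+i) =
            trans (lookup≡nth l₀ (l₀ ∷ steps) (cnext i)) (cong (nth l₀ (l₀ ∷ steps)) next≡1+i)
          ... | inj₂ (i≡len , next≡0) =
            trans (cong hs next≡0) (sym (trans (cong (nth l₀ steps) i≡len) (nth-length l₀ steps)))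

        -- A step reversed inside the cycle would make each of the two positions the successor of the other.
        not-reversed : ∀ i j → i ≢ j → hs i ≢ α⁺ (hs j)
        not-reversed zero    zero    i≢j _ = i≢j refl
        not-reversed zero    (suc j) _   e = All.lookup l₀≢αrs (∈-lookup j) e
        not-reversed (suc i) zero    _   e =
          All.lookup l₀≢αrs (∈-lookup i) (trans (sym (α-invol l₀)) (cong α⁺ (sym e)))
        not-reversed (suc i) (suc j) _   e =
          ℕP.<-asym (ℕP.≤-reflexive (sym i-after-j)) (ℕP.≤-reflexive (sym j-after-i))
          where
          i≡next-j : suc i ≡ cnext (suc j)
          i≡next-j = vertex-injective _ _ (trans (cong vertex e) (chained (suc j)))
          j≡next-i : suc j ≡ cnext (suc i)
          j≡next-i = vertex-injective _ _
            (trans (cong vertex (trans (sym (α-invol _)) (cong α⁺ (sym e)))) (chained (suc i)))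
          i-after-j : toℕ (suc i) ≡ suc (toℕ (suc j))
          i-after-j = trans (cong toℕ i≡next-j) (cnext-suc (suc j) (λ next≡0 → case trans i≡next-j next≡0 of λ ()))
          j-after-i : toℕ (suc j) ≡ suc (toℕ (suc i))
          j-after-i = trans (cong toℕ j≡next-i) (cnext-suc (suc i) (λ next≡0 → case trans j≡next-i next≡0 of λ ()))

      acyclic⇒bridge : ∀ {T h} → EdgeSet M T → ¬ Cycle M T → h ∈ T → ¬ Connected M (T ─ edge M h) (α⁺ h) h
      acyclic⇒bridge {T} {h} eT acyclic h∈T αh→h =
        acyclic (SimpleWalk-closing⇒Cycle (SP.p─q⊆p T (edge M h)) (eT h h∈T) W αh≢αrs)
        where
        W : SimpleWalk (T ─ edge M h) (vertex (α⁺ h)) (vertex (α⁺ (α⁺ h)))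
        W = subst (SimpleWalk _ _) (cong vertex (sym (α-invol h)))
              (Connected⇒SimpleWalk (EdgeSet-─ eT (EdgeSet-edge h)) αh→h)
        αh≢αrs : All (λ r → α⁺ h ≢ α⁺ r) (SimpleWalk.steps W)
        αh≢αrs = All.map
          (λ r∈ αh≡αr → x∈p─q⇒x∉q T (edge M h) r∈ (subst (_∈ edge M h) (α-injective αh≡αr) (g∈edge h)))
          (Walk-∈ (SimpleWalk.walk W))

      Connected⊥-HasClasses : HasClasses (Connected M ⊥) v
      Connected⊥-HasClasses = vertex , proj₁ (proj₂ NV) , λ h h′ →
        mk⇔ (SameVertex⇒Connected ∘ vertex-≡⇒SameVertex) (Connected-invariant vertex step)
        where
        step : ∀ {x y} → CompStep M ⊥ x y → vertex x ≡ vertex y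
        step (around h)    = SameVertex⇒vertex-≡ (1 , refl)
        step (around⁻ h)   = sym (SameVertex⇒vertex-≡ (1 , inverseʳ σ))
        step (cross h h∈⊥) = ⊥-elim (SP.∉⊥ h∈⊥)

      subforest-bridge : ∀ {T Y g} → EdgeSet M T → ¬ Cycle M T → Y ⊆ T → g ∈ Y →
        ¬ Connected M (Y ─ edge M g) g (α⁺ g)
      subforest-bridge eT acyclic Y⊆T g∈Y g→αg = acyclic⇒bridge eT acyclic (Y⊆T g∈Y)
        (Connected-sym (EdgeSet-─ eT (EdgeSet-edge _)) (Connected-mono (p─q-monotone Y⊆T) g→αg))

      forest-components : ∀ {T} → EdgeSet M T → ¬ Cycle M T → ∀ {Y} → EdgeSet M Y → Y ⊆ T →
        ∃[ c ] HasClasses (Connected M Y) c × c + #E M Y ≡ v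
      forest-components {T} eT acyclic = edge-induction P base step
        where
        P : Subset n → Set
        P Y = Y ⊆ T → ∃[ c ] HasClasses (Connected M Y) c × c + #E M Y ≡ v
        base : P ⊥
        base _ = v , Connected⊥-HasClasses ,
                 trans (cong (v +_) #E-⊥) (ℕP.+-identityʳ v)
        step : ∀ {Y g} → EdgeSet M Y → g ∈ Y → P (Y ─ edge M g) → P Y
        step {Y} {g} eY g∈Y IH Y⊆T with IH (Y⊆T ∘ SP.p─q⊆p Y (edge M g))
        ... | c , H , count with HasClasses-∪edge H (subforest-bridge eT acyclic Y⊆T g∈Y)
        ...   | b , refl , H′ =
          b , subst (λ Z → HasClasses (Connected M Z) b) ([p─q]∪q≡p (edge⊆ eY g∈Y)) H′ , (begin
          b + #E M Y                   ≡⟨ cong (b +_) (#E-remove-edge eY g∈Y) ⟩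
          b + suc (#E M (Y ─ edge M g)) ≡⟨ ℕP.+-suc b _ ⟩
          suc b + #E M (Y ─ edge M g)   ≡⟨ count ⟩
          v                             ∎)
          where open ≡-Reasoning

      Via⇒exchange-IsSpanningTree : ∀ {T d a} → IsSpanningTree M T → d ∈ T → Via (T ─ edge M d) d a (α⁺ a) →
        IsSpanningTree M ((T ─ edge M d) ∪ edge M a)
      Via⇒exchange-IsSpanningTree {T} {d} {a} tree@(eT , _ , acyclic) d∈T via =
        exchange-IsSpanningTree tree a↛αa (d→αd via)
        where
        Y : Subset n
        Y = T ─ edge M d
        eY : EdgeSet M Y
        eY = EdgeSet-─ eT (EdgeSet-edge d)
        a↛αa : ¬ Connected M Y a (α⁺ a)
        a↛αa a→αa = acyclic⇒bridge eT acyclic d∈T (αd→d via)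
          where
          αd→d : Via Y d a (α⁺ a) → Connected M Y (α⁺ d) d
          αd→d (inj₁ (a→d , αd→αa)) = αd→αa ◅◅ Connected-sym eY a→αa ◅◅ a→d
          αd→d (inj₂ (a→αd , d→αa)) = Connected-sym eY (d→αa ◅◅ Connected-sym eY a→αa ◅◅ a→αd)
        up : ∀ {x y} → Connected M Y x y → Connected M (Y ∪ edge M a) x y
        up = Connected-mono (SP.p⊆p∪q (edge M a))
        d→αd : Via Y d a (α⁺ a) → Connected M (Y ∪ edge M a) d (α⁺ d)
        d→αd (inj₁ (a→d , αd→αa)) =
          up (Connected-sym eY a→d) ◅◅ cross a (SP.x∈p∪q⁺ (inj₂ (g∈edge a))) ◅ up (Connected-sym eY αd→αa)
        d→αd (inj₂ (a→αd , d→αa)) =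
          up d→αa ◅◅ cross (α⁺ a) (SP.x∈p∪q⁺ (inj₂ (αg∈edge a))) ◅
          subst (λ z → Connected M (Y ∪ edge M a) z (α⁺ d)) (sym (α-invol a)) (up a→αd)

      -- The motion function of a spanning tree

      module _ {T : Subset n} (tree : IsSpanningTree M T) where
        open Tree M T using (t; _≤H_; _≤E_; ExternallyActive; InternallyActive; InTreeInterval)

        private
          eT : EdgeSet M T
          eT = proj₁ tree
          connected : ∀ h h′ → Connected M T h h′
          connected = proj₁ (proj₂ tree)
          acyclic : ¬ Cycle M T
          acyclic = proj₂ (proj₂ tree)

        t-∈ : ∀ {h} → h ∈ T → t h ≡ σ⁺ (α⁺ h)
        t-∈ {h} h∈T with h SP.∈? T
        ... | yes _   = refl
        ... | no h∉T  = ⊥-elim (h∉T h∈T)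

        t-∉ : ∀ {h} → h ∉ T → t h ≡ σ⁺ h
        t-∉ {h} h∉T with h SP.∈? T
        ... | yes h∈T = ⊥-elim (h∉T h∈T)
        ... | no _    = refl

        t-injective : Injective _≡_ _≡_ t
        t-injective {h} {h′} e with h SP.∈? T | h′ SP.∈? T
        ... | yes _   | yes _    = α-injective (σ-injective e)
        ... | yes h∈T | no h′∉T  = ⊥-elim (h′∉T (subst (_∈ T) (σ-injective e) (eT h h∈T)))
        ... | no h∉T  | yes h′∈T = ⊥-elim (h∉T (subst (_∈ T) (sym (σ-injective e)) (eT h′ h′∈T)))
        ... | no _    | no _     = σ-injective e

        t-step : ∀ {Y y} → (y ∈ T → y ∈ Y) → Connected M Y y (t y)
        t-step {Y} {y} ∈Y with y SP.∈? T
        ... | yes y∈T = cross y (∈Y y∈T) ◅ around (α⁺ y) ◅ ε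
        ... | no _    = around y ◅ ε

        -- The tour that leaves along a tree edge h can only come back to h across h itself, h being a bridge.
        tree-edge-tour : ∀ {h} → h ∈ T → Orbit t h (α⁺ h)
        tree-edge-tour {h} h∈T = [ id , ⊥-elim ∘ acyclic⇒bridge eT acyclic h∈T ∘ reaches-h ]′ (tour p)
          where
          Y : Subset n
          Y = T ─ edge M h
          p : ℕ
          p = proj₁ (iter-periodic t-injective h)
          reaches-h : Connected M Y (α⁺ h) (iter t p (t h)) → Connected M Y (α⁺ h) h
          reaches-h = subst (Connected M Y (α⁺ h)) (trans (iter-comm t p h) (proj₂ (iter-periodic t-injective h)))
          tour : ∀ k → Orbit t h (α⁺ h) ⊎ Connected M Y (α⁺ h) (iter t k (t h))
          tour zero = inj₂ (subst (Connected M Y (α⁺ h)) (sym (t-∈ h∈T)) (around (α⁺ h) ◅ ε))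
          tour (suc k) with tour k
          ... | inj₁ back = inj₁ back
          ... | inj₂ αh→y with iter t k (t h) ≟ α⁺ h | iter t k (t h) ≟ h
          ...   | yes y≡αh | _       = inj₁ (suc k , trans (sym (iter-comm t k h)) y≡αh)
          ...   | no _     | yes y≡h =
            ⊥-elim (acyclic⇒bridge eT acyclic h∈T (subst (Connected M Y (α⁺ h)) y≡h αh→y))
          ...   | no y≢αh  | no y≢h  = inj₂ (αh→y ◅◅ t-step λ y∈T →
                  SP.x∈p∧x∉q⇒x∈p─q y∈T (λ y∈h → [ y≢h , y≢αh ]′ (∈edge⁻ h y∈h)))

        σ-in-t-orbit : ∀ h → Orbit t h (σ⁺ h)
        σ-in-t-orbit h with h SP.∈? T
        ... | yes h∈T = Orbit-trans t (tree-edge-tour h∈T) (1 , trans (t-∈ (eT h h∈T)) (cong σ⁺ (α-invol h)))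
        ... | no h∉T  = 1 , t-∉ h∉T

        CompStep⇒Orbit : ∀ {a b} → CompStep M T a b → Orbit t a b
        CompStep⇒Orbit (around h)    = σ-in-t-orbit h
        CompStep⇒Orbit (around⁻ h)   =
          Orbit-sym t-injective (subst (Orbit t (σ⁻ h)) (inverseʳ σ) (σ-in-t-orbit (σ⁻ h)))
        CompStep⇒Orbit (cross h h∈T) = tree-edge-tour h∈T

        t-orbit-full : ∀ h → Orbit t root h
        t-orbit-full h = Star.fold (Orbit t) (Orbit-trans t ∘ CompStep⇒Orbit) (0 , refl) (connected root h)

        ≤H-antisym : ∀ {x y} → x ≤H y → y ≤H x → x ≡ y
        ≤H-antisym (i , j , (i<n , i↦x) , (j<n , j↦y) , i≤j) (j′ , i′ , (j′<n , j′↦y) , (i′<n , i′↦x) , j′≤i′) =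
          trans (sym i↦x) (trans (cong (λ k → iter t k root) i≡j) j↦y)
          where
          unique : ∀ {k l} → k < n → l < n → iter t k root ≡ iter t l root → k ≡ l
          unique = full-orbit⇒positions-unique t-injective t-orbit-full
          i≡j : i ≡ j
          i≡j = ℕP.≤-antisym i≤j (subst₂ _≤_ (unique j′<n j<n (trans j′↦y (sym j↦y)))
                                              (unique i′<n i<n (trans i′↦x (sym i↦x))) j′≤i′)

        ≤E-antisym : ∀ {e e′} → e ≤E e′ → e′ ≤E e → ∃[ x ] x ∈ edge M e × x ∈ edge M e′
        ≤E-antisym (x , x∈e , x≤) (y , y∈e′ , y≤) =
          x , x∈e , subst (_∈ edge M _) (≤H-antisym (y≤ x x∈e) (x≤ y y∈e′)) y∈e′

        active-not-Via : ∀ {a d} → ExternallyActive a → InternallyActive d → ¬ Via (T ─ edge M d) d a (α⁺ a)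
        active-not-Via {a} {d} (a∉T , a-min) (d∈T , d-min) via = a∉T a∈T
          where
          exchanged : IsSpanningTree M ((T ─ edge M d) ∪ edge M a)
          exchanged = Via⇒exchange-IsSpanningTree tree d∈T via
          a∈T : a ∈ T
          a∈T with ≤E-antisym (a-min d exchanged) (d-min a exchanged)
          ... | x , x∈a , x∈d = edge⊆ eT (edge⊆ eT d∈T x∈d) (subst (a ∈_) (sym (∈edge⇒edge≡ x∈a)) (g∈edge a))

        -- Subgraphs in the tree-interval

        module _ {S : Subset n} (interval : InTreeInterval S) where

          private
            eS : EdgeSet M S
            eS = proj₁ interval

          external-Connected : ∀ {a} → a ∈ S → a ∉ T → Connected M (T ∩ S) a (α⁺ a)
          external-Connected {a} a∈S a∉T
            with Connected⇒avoids-or-Via (EdgeSet-─ eT eS) (SP.p─q⊆p T S) (connected a (α⁺ a))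
          ... | inj₁ a→αa = Connected-mono (p─[p─q]⊆p∩q T S) a→αa
          ... | inj₂ (d , d∈T─S , via) = ⊥-elim (active-not-Via
                (proj₂ (proj₂ interval) a a∉T a∈S)
                (proj₁ (proj₂ interval) d (SP.p─q⊆p T S d∈T─S) (x∈p─q⇒x∉q T S d∈T─S)) via)

          interval-Connected⇔ : ∀ x y → Connected M S x y ⇔ Connected M (T ∩ S) x y
          interval-Connected⇔ x y = mk⇔ (Connected-reroute within-T∩S) (Connected-mono (SP.p∩q⊆q T S))
            where
            within-T∩S : ∀ {h} → h ∈ S → Connected M (T ∩ S) h (α⁺ h)
            within-T∩S {h} h∈S with h SP.∈? T
            ... | yes h∈T = cross h (SP.x∈p∩q⁺ (h∈T , h∈S)) ◅ ε
            ... | no h∉T  = external-Connected h∈S h∉T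

          interval-counts : ∀ {c} → NumComponents M S c →
            c ≡ suc (#E M (T ─ S)) × #E M S + c ≡ #E M (S ─ T) + v
          interval-counts {c} NC
            with forest-components eT acyclic (EdgeSet-∩ eT eS) (SP.p∩q⊆p T S) | forest-components eT acyclic eT id
          ... | cK , HK , countK | cT , HT , countT = trans c≡cK cK≡ , (begin
            #E M S + c                            ≡⟨ cong₂ _+_ #S c≡cK ⟩
            (#E M (T ∩ S) + #E M (S ─ T)) + cK    ≡⟨ rearrange (#E M (T ∩ S)) (#E M (S ─ T)) cK ⟩
            #E M (S ─ T) + (cK + #E M (T ∩ S))    ≡⟨ cong (#E M (S ─ T) +_) countK ⟩
            #E M (S ─ T) + v                      ∎)
            where
            open ≡-Reasoning
            rearrange : ∀ k a c → (k + a) + c ≡ a + (c + k)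
            rearrange = solve-∀
            c≡cK : c ≡ cK
            c≡cK = HasClasses-unique (HasClasses-resp-⇔ interval-Connected⇔ NC) HK
            cT≡1 : cT ≡ 1
            cT≡1 = HasClasses-unique HT (total⇒HasClasses-1 root connected)
            #S : #E M S ≡ #E M (T ∩ S) + #E M (S ─ T)
            #S = trans (#E-split S T) (cong (λ Z → #E M Z + #E M (S ─ T)) (SP.∩-comm S T))
            cK≡ : cK ≡ suc (#E M (T ─ S))
            cK≡ = ℕP.+-cancelʳ-≡ (#E M (T ∩ S)) cK (suc (#E M (T ─ S))) (begin
              cK + #E M (T ∩ S)                   ≡⟨ countK ⟩
              v                                   ≡⟨ countT ⟨
              cT + #E M T                         ≡⟨ cong₂ _+_ cT≡1 (#E-split T S) ⟩
              suc (#E M (T ∩ S) + #E M (T ─ S))   ≡⟨ cong suc (ℕP.+-comm (#E M (T ∩ S)) _) ⟩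
              suc (#E M (T ─ S)) + #E M (T ∩ S)   ∎)

open import Defs
open import Data.Nat using (ℕ)
import Data.Nat as ℕ
import Data.Nat.Properties as ℕP
open import Data.Integer using (ℤ; +_; _-_; _+_; _⊖_)
import Data.Integer.Properties as ℤP
open import Data.Fin.Subset using (Subset; _─_)
open import Data.Product using (_×_; _,_)
open import Relation.Binary.PropositionalEquality using (_≡_; refl; cong; module ≡-Reasoning)
open TreeInterval using (interval-counts)

m+n≡o+p⇒[+m]+[+n]-[+p]≡[+o] : ∀ m n o p → m ℕ.+ n ≡ o ℕ.+ p → + m + + n - + p ≡ + o
m+n≡o+p⇒[+m]+[+n]-[+p]≡[+o] m n o p e = begin
  + m + + n - + p      ≡⟨ cong (_- + p) (ℤP.pos-+ m n) ⟨
  + (m ℕ.+ n) - + p    ≡⟨ ℤP.[+m]-[+n]≡m⊖n (m ℕ.+ n) p ⟩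
  (m ℕ.+ n) ⊖ p        ≡⟨ cong (_⊖ p) e ⟩
  (o ℕ.+ p) ⊖ p        ≡⟨ ℤP.⊖-≥ (ℕP.m≤n+m p o) ⟩
  + (o ℕ.+ p ℕ.∸ p)    ≡⟨ cong +_ (ℕP.m+n∸n≡m o p) ⟩
  + o                  ∎
  where open ≡-Reasoning

lemma12 : ∀ {n : ℕ} (M : RootedMap n) (T S : Subset n) (v c : ℕ) →
    IsSpanningTree M T →
    Tree.InTreeInterval M T S →
    NumVertices M v →
    NumComponents M S c →
    ((+ c) - (+ 1) ≡ + #E M (T ─ S)) ×
    ((+ #E M S) + (+ c) - (+ v) ≡ + #E M (S ─ T))
lemma12 M T S v c tree interval NV NC with interval-counts M NV tree interval NC
... | c≡1+#D , #S+c≡#A+v =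
  cong (λ k → + k - + 1) c≡1+#D , m+n≡o+p⇒[+m]+[+n]-[+p]≡[+o] (#E M S) c (#E M (S ─ T)) v #S+c≡#A+v
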